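{- Let $m\ge1$ and let $A=[A_{ij}]\in\{0,1\}^{m\times m}$ be an invertible matrix each of whose rows has at most two non-zero entries. Then every entry of $A^{ -1}$ lies in $\{0,1,-1,\tfrac12,-\tfrac12\}$. -}

module Defs where

open import Data.Nat using (ℕ; zero; suc)
open import Data.Fin using (Fin; zero; suc)
open import Data.List using (length; filter; allFin)
open import Data.Rational using (ℚ; 0ℚ; 1ℚ; _+_; _*_)
open import Data.Rational.Properties using (_≟_)
open import Relation.Nullary using (¬?)
open import Relation.Binary.PropositionalEquality using (_≡_)
open import Relation.Nullary.Decidable using (⌊_⌋)
open import Data.Bool using (if_then_else_)

Matrix : ℕ → Set
Matrix m = Fin m → Fin m → ℚ

Σ : ∀ {n} → (Fin n → ℚ) → ℚ
Σ {zero} f = 0ℚ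
Σ {suc n} f = f zero + Σ (λ j → f (suc j))

_⊗_ : ∀ {m} → Matrix m → Matrix m → Matrix m
(A ⊗ B) i k = Σ (λ j → A i j * B j k)

I : ∀ {m} → Matrix m
I i j = if ⌊ Data.Fin._≟_ i j ⌋ then 1ℚ else 0ℚ

nnz : ∀ {n} → (Fin n → ℚ) → ℕ
nnz {n} r = length (filter (λ j → ¬? (r j ≟ 0ℚ)) (allFin n))

-- Fix a column x of B = A⁻¹ and a non-zero entry c of it, and let z be x with every entry
-- outside {c, -c} replaced by 0. Since A x is the unit vector eⱼ, every row r ≠ j of A has
-- at most two unit entries whose x-values sum to 0, so they are 0 and 0 or u and -u; this
-- pattern survives the odd map x ↦ z, hence A z vanishes off row j and A z = μ A x. As A is
-- injective, z = μ x, and comparing the i-th entries gives μ = 1, so all entries of x lie in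
-- {0, c, -c}. Row j then writes 1 as a sum of at most two of these, forcing c ∈ {±1, ±½}.
module Submission where

open import Defs
open import Data.Nat using (ℕ; zero; suc; _≤_; _≥_; s≤s)
open import Data.Fin using (Fin)
open import Data.Sum using (_⊎_)
open import Data.Rational using (ℚ; 0ℚ; 1ℚ; ½; -½; -_)
open import Relation.Binary.PropositionalEquality using (_≡_)

open import Algebra.Bundles using (CommutativeMonoid; CommutativeRing)
import Algebra.Properties.CommutativeSemigroup as CommutativeSemigroupProperties
import Algebra.Properties.Group as GroupProperties
import Algebra.Properties.Semiring.Sum as SemiringSum
open import Data.Empty using (⊥-elim)
open import Data.Fin as Fin using (zero; suc)
open import Data.List using (List; []; _∷_; length; filter; map; foldr; tabulate; allFin)
open import Data.Rational using (_+_; _*_; 1/_; ≢-nonZero)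
open import Data.Rational.Properties
  using ( _≟_; +-0-group; +-*-commutativeRing; +-identityˡ; +-identityʳ; +-inverseʳ; +-inverseˡ
        ; neg-distrib-+; *-1-commutativeMonoid; *-assoc; *-identityˡ; *-identityʳ; *-zeroˡ; *-zeroʳ
        ; *-distribˡ-+; *-distribʳ-+; *-inverseʳ)
open import Data.Sum using (inj₁; inj₂)
open import Data.Vec.Functional using (Vector)
open import Function using (_∘_; id)
open import Relation.Binary.PropositionalEquality using (refl; sym; trans; cong; subst; _≢_; module ≡-Reasoning)
open import Relation.Nullary using (Dec; yes; no; ¬?)
open import Relation.Nullary.Decidable using (_⊎-dec_)

open ≡-Reasoning
open GroupProperties +-0-group using (⁻¹-involutive; inverseʳ-unique)
open CommutativeSemigroupProperties (CommutativeMonoid.commutativeSemigroup *-1-commutativeMonoid)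
  using (x∙yz≈y∙xz)
open SemiringSum (CommutativeRing.semiring +-*-commutativeRing)
  using (sum; sum-cong-≗; sum-replicate-zero; ∑-comm; *-distribˡ-sum; *-distribʳ-sum)

0≢1 : 0ℚ ≢ 1ℚ
0≢1 ()

x+x≡q⇒x≡½*q : ∀ x q → x + x ≡ q → x ≡ ½ * q
x+x≡q⇒x≡½*q x q x+x≡q = begin
  x              ≡⟨ sym (*-identityˡ x) ⟩
  (½ + ½) * x    ≡⟨ *-distribʳ-+ x ½ ½ ⟩
  ½ * x + ½ * x  ≡⟨ sym (*-distribˡ-+ ½ x x) ⟩
  ½ * (x + x)    ≡⟨ cong (½ *_) x+x≡q ⟩
  ½ * q          ∎

*-identityˡ-unique : ∀ a q → q ≢ 0ℚ → a * q ≡ q → a ≡ 1ℚ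
*-identityˡ-unique a q q≢0 aq≡q = begin
  a                ≡⟨ sym (*-identityʳ a) ⟩
  a * 1ℚ           ≡⟨ cong (a *_) (sym (*-inverseʳ q)) ⟩
  a * (q * 1/ q)   ≡⟨ sym (*-assoc a q (1/ q)) ⟩
  (a * q) * 1/ q   ≡⟨ cong (_* 1/ q) aq≡q ⟩
  q * 1/ q         ≡⟨ *-inverseʳ q ⟩
  1ℚ               ∎
  where instance _ = ≢-nonZero q≢0

infix 7 _∙_
_∙_ : ∀ {n} → Vector ℚ n → Vector ℚ n → ℚ
u ∙ v = sum (λ k → u k * v k)

infixr 7 _·_
_·_ : ∀ {m} → Matrix m → Vector ℚ m → Vector ℚ m
(M · v) r = M r ∙ v

Σ≡sum : ∀ {n} (f : Vector ℚ n) → Σ f ≡ sum f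
Σ≡sum {zero} f = refl
Σ≡sum {suc n} f = cong (f zero +_) (Σ≡sum (f ∘ suc))

·-scale : ∀ {m} (M : Matrix m) μ v r → (M · (λ k → μ * v k)) r ≡ μ * (M · v) r
·-scale M μ v r = begin
  sum (λ k → M r k * (μ * v k))  ≡⟨ sum-cong-≗ (λ k → x∙yz≈y∙xz (M r k) μ (v k)) ⟩
  sum (λ k → μ * (M r k * v k))  ≡⟨ sym (*-distribˡ-sum μ (λ k → M r k * v k)) ⟩
  μ * (M · v) r                  ∎

·-assoc : ∀ {m} (B A : Matrix m) z l → (B · A · z) l ≡ ((B ⊗ A) · z) l
·-assoc B A z l = begin
  sum (λ r → B l r * sum (λ k → A r k * z k))    ≡⟨ sum-cong-≗ (λ r → *-distribˡ-sum (B l r) (λ k → A r k * z k)) ⟩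
  sum (λ r → sum (λ k → B l r * (A r k * z k)))  ≡⟨ ∑-comm (λ r k → B l r * (A r k * z k)) ⟩
  sum (λ k → sum (λ r → B l r * (A r k * z k)))  ≡⟨ sum-cong-≗ (λ k → sum-cong-≗ (λ r → sym (*-assoc (B l r) (A r k) (z k)))) ⟩
  sum (λ k → sum (λ r → B l r * A r k * z k))    ≡⟨ sum-cong-≗ (λ k → sym (*-distribʳ-sum (z k) (λ r → B l r * A r k))) ⟩
  sum (λ k → sum (λ r → B l r * A r k) * z k)    ≡⟨ sum-cong-≗ (λ k → cong (_* z k) (sym (Σ≡sum (λ r → B l r * A r k)))) ⟩
  ((B ⊗ A) · z) l                                ∎

I-diag : ∀ {m} (l : Fin m) → I l l ≡ 1ℚ
I-diag l with l Fin.≟ l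
... | yes _   = refl
... | no l≢l  = ⊥-elim (l≢l refl)

I-off : ∀ {m} {l k : Fin m} → l ≢ k → I l k ≡ 0ℚ
I-off {l = l} {k} l≢k with l Fin.≟ k
... | yes l≡k = ⊥-elim (l≢k l≡k)
... | no _    = refl

I-suc : ∀ {m} (l k : Fin m) → I (suc l) (suc k) ≡ I l k
I-suc l k with l Fin.≟ k
... | yes _ = refl
... | no _  = refl

I-· : ∀ {m} (z : Vector ℚ m) l → (I · z) l ≡ z l
I-· {suc m} z zero = begin
  1ℚ * z zero + sum (λ k → 0ℚ * z (suc k))  ≡⟨ cong (_+ sum (λ k → 0ℚ * z (suc k))) (*-identityˡ (z zero)) ⟩
  z zero + sum (λ k → 0ℚ * z (suc k))       ≡⟨ cong (z zero +_) (sum-cong-≗ (λ k → *-zeroˡ (z (suc k)))) ⟩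
  z zero + sum (λ (_ : Fin m) → 0ℚ)         ≡⟨ cong (z zero +_) (sum-replicate-zero m) ⟩
  z zero + 0ℚ                               ≡⟨ +-identityʳ (z zero) ⟩
  z zero                                    ∎
I-· {suc m} z (suc l) = begin
  0ℚ * z zero + sum (λ k → I (suc l) (suc k) * z (suc k))  ≡⟨ cong (_+ rest) (*-zeroˡ (z zero)) ⟩
  0ℚ + sum (λ k → I (suc l) (suc k) * z (suc k))           ≡⟨ +-identityˡ rest ⟩
  sum (λ k → I (suc l) (suc k) * z (suc k))                ≡⟨ sum-cong-≗ (λ k → cong (_* z (suc k)) (I-suc l k)) ⟩
  (I · (z ∘ suc)) l                                        ≡⟨ I-· (z ∘ suc) l ⟩
  z (suc l)                                                ∎
  where rest = sum (λ k → I (suc l) (suc k) * z (suc k))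

·-injective : ∀ {m} (A B : Matrix m) → (∀ i k → (B ⊗ A) i k ≡ I i k) →
              ∀ {u v} → (∀ r → (A · u) r ≡ (A · v) r) → ∀ l → u l ≡ v l
·-injective A B BA≡I {u} {v} Au≡Av l = begin
  u l              ≡⟨ sym (I-· u l) ⟩
  (I · u) l        ≡⟨ sum-cong-≗ (λ k → cong (_* u k) (sym (BA≡I l k))) ⟩
  ((B ⊗ A) · u) l  ≡⟨ sym (·-assoc B A u l) ⟩
  (B · A · u) l    ≡⟨ sum-cong-≗ (λ r → cong (B l r *_) (Au≡Av r)) ⟩
  (B · A · v) l    ≡⟨ ·-assoc B A v l ⟩
  ((B ⊗ A) · v) l  ≡⟨ sum-cong-≗ (λ k → cong (_* v k) (BA≡I l k)) ⟩
  (I · v) l        ≡⟨ I-· v l ⟩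
  v l              ∎

Binary : ∀ {n} → Vector ℚ n → Set
Binary w = ∀ k → w k ≡ 0ℚ ⊎ w k ≡ 1ℚ

sumᴸ : List ℚ → ℚ
sumᴸ = foldr _+_ 0ℚ

-- Stated for an arbitrary enumeration g because the tail of allFin n = tabulate id is
-- tabulate suc, not an allFin.
∙-support : ∀ {n N} (g : Fin n → Fin N) (w : Vector ℚ N) → Binary w → ∀ y →
            (w ∘ g) ∙ (y ∘ g) ≡ sumᴸ (map y (filter (λ j → ¬? (w j ≟ 0ℚ)) (tabulate g)))
∙-support {zero} g w binary y = refl
∙-support {suc n} g w binary y with w (g zero) ≟ 0ℚ | binary (g zero)
... | yes w₀≡0 | _ = begin
  w (g zero) * y (g zero) + rest  ≡⟨ cong (λ t → t * y (g zero) + rest) w₀≡0 ⟩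
  0ℚ * y (g zero) + rest          ≡⟨ cong (_+ rest) (*-zeroˡ (y (g zero))) ⟩
  0ℚ + rest                       ≡⟨ +-identityˡ rest ⟩
  rest                            ≡⟨ ∙-support (g ∘ suc) w binary y ⟩
  _                               ∎
  where rest = (w ∘ g ∘ suc) ∙ (y ∘ g ∘ suc)
... | no w₀≢0 | inj₁ w₀≡0 = ⊥-elim (w₀≢0 w₀≡0)
... | no _    | inj₂ w₀≡1 = begin
  w (g zero) * y (g zero) + rest  ≡⟨ cong (λ t → t * y (g zero) + rest) w₀≡1 ⟩
  1ℚ * y (g zero) + rest          ≡⟨ cong (_+ rest) (*-identityˡ (y (g zero))) ⟩
  y (g zero) + rest               ≡⟨ cong (y (g zero) +_) (∙-support (g ∘ suc) w binary y) ⟩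
  _                               ∎
  where rest = (w ∘ g ∘ suc) ∙ (y ∘ g ∘ suc)

data RowShape {n} (w : Vector ℚ n) : Set where
  empty  : (∀ y → w ∙ y ≡ 0ℚ) → RowShape w
  single : ∀ a → (∀ y → w ∙ y ≡ y a) → RowShape w
  pair   : ∀ a b → (∀ y → w ∙ y ≡ y a + y b) → RowShape w

rowShape : ∀ {n} (w : Vector ℚ n) → Binary w → nnz w ≤ 2 → RowShape w
rowShape {n} w binary nnz≤2 = shape (filter (λ k → ¬? (w k ≟ 0ℚ)) (allFin n)) nnz≤2 (∙-support id w binary)
  where
  shape : ∀ S → length S ≤ 2 → (∀ y → w ∙ y ≡ sumᴸ (map y S)) → RowShape w
  shape []           _ w∙≡ = empty w∙≡
  shape (a ∷ [])     _ w∙≡ = single a (λ y → trans (w∙≡ y) (+-identityʳ (y a)))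
  shape (a ∷ b ∷ []) _ w∙≡ = pair a b (λ y → trans (w∙≡ y) (cong (y a +_) (+-identityʳ (y b))))
  shape (_ ∷ _ ∷ _ ∷ _) (s≤s (s≤s ())) _

Odd : (ℚ → ℚ) → Set
Odd f = ∀ u → f (- u) ≡ - f u

odd-zero : ∀ {f} → Odd f → f 0ℚ ≡ 0ℚ
odd-zero {f} odd = x+x≡q⇒x≡½*q (f 0ℚ) 0ℚ (begin
  f 0ℚ + f 0ℚ    ≡⟨ cong (f 0ℚ +_) (odd 0ℚ) ⟩
  f 0ℚ + - f 0ℚ  ≡⟨ +-inverseʳ (f 0ℚ) ⟩
  0ℚ             ∎)

odd-preserves-kernel : ∀ {n f} → Odd f → (w : Vector ℚ n) → Binary w → nnz w ≤ 2 →
                       ∀ x → w ∙ x ≡ 0ℚ → w ∙ (f ∘ x) ≡ 0ℚ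
odd-preserves-kernel {f = f} odd w binary nnz≤2 x w∙x≡0 with rowShape w binary nnz≤2
... | empty w∙≡    = w∙≡ (f ∘ x)
... | single a w∙≡ = begin
  w ∙ (f ∘ x)  ≡⟨ w∙≡ (f ∘ x) ⟩
  f (x a)      ≡⟨ cong f (trans (sym (w∙≡ x)) w∙x≡0) ⟩
  f 0ℚ         ≡⟨ odd-zero odd ⟩
  0ℚ           ∎
... | pair a b w∙≡ = begin
  w ∙ (f ∘ x)            ≡⟨ w∙≡ (f ∘ x) ⟩
  f (x a) + f (x b)      ≡⟨ cong (λ t → f (x a) + f t) (inverseʳ-unique (x a) (x b) (trans (sym (w∙≡ x)) w∙x≡0)) ⟩
  f (x a) + f (- x a)    ≡⟨ cong (f (x a) +_) (odd (x a)) ⟩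
  f (x a) + - f (x a)    ≡⟨ +-inverseʳ (f (x a)) ⟩
  0ℚ                     ∎

infix 4 _≡±_ _≡0±_ _≡±?_
_≡±_ : ℚ → ℚ → Set
u ≡± c = u ≡ c ⊎ u ≡ - c

_≡0±_ : ℚ → ℚ → Set
u ≡0± c = u ≡ 0ℚ ⊎ u ≡± c

_≡±?_ : ∀ u c → Dec (u ≡± c)
u ≡±? c = (u ≟ c) ⊎-dec (u ≟ - c)

neg-≡± : ∀ {u c} → u ≡± c → - u ≡± c
neg-≡± (inj₁ refl) = inj₂ refl
neg-≡± {c = c} (inj₂ refl) = inj₁ (⁻¹-involutive c)

restrict± : ℚ → ℚ → ℚ
restrict± c u with u ≡±? c
... | yes _ = u
... | no _  = 0ℚ

restrict±-odd : ∀ c → Odd (restrict± c)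
restrict±-odd c u with u ≡±? c | - u ≡±? c
... | yes _    | yes _     = refl
... | no _     | no _      = refl
... | yes u≡±c | no -u≢±c  = ⊥-elim (-u≢±c (neg-≡± u≡±c))
... | no u≢±c  | yes -u≡±c = ⊥-elim (u≢±c (subst (_≡± c) (⁻¹-involutive u) (neg-≡± -u≡±c)))

restrict±-self : ∀ c → restrict± c c ≡ c
restrict±-self c with c ≡±? c
... | yes _   = refl
... | no c≢±c = ⊥-elim (c≢±c (inj₁ refl))

restrict±-fixed : ∀ c u → restrict± c u ≡ u → u ≡0± c
restrict±-fixed c u fixed with u ≡±? c
... | yes u≡±c = inj₂ u≡±c
... | no _     = inj₁ (sym fixed)

≡0±-unit : ∀ {u c} → u ≡0± c → u ≡ 1ℚ → c ≡ 1ℚ ⊎ c ≡ - 1ℚ ⊎ c ≡ ½ ⊎ c ≡ -½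
≡0±-unit (inj₁ refl)        0≡1 = ⊥-elim (0≢1 0≡1)
≡0±-unit (inj₂ (inj₁ refl)) c≡1 = inj₁ c≡1
≡0±-unit {c = c} (inj₂ (inj₂ refl)) -c≡1 =
  inj₂ (inj₁ (trans (sym (⁻¹-involutive c)) (cong -_ -c≡1)))

≡0±-sum-unit : ∀ {u v c} → u ≡0± c → v ≡0± c → u + v ≡ 1ℚ →
               c ≡ 1ℚ ⊎ c ≡ - 1ℚ ⊎ c ≡ ½ ⊎ c ≡ -½
≡0±-sum-unit {v = v} (inj₁ refl) v≡0±c 0+v≡1 =
  ≡0±-unit v≡0±c (trans (sym (+-identityˡ v)) 0+v≡1)
≡0±-sum-unit {u = u} u≡0±c (inj₁ refl) u+0≡1 =
  ≡0±-unit u≡0±c (trans (sym (+-identityʳ u)) u+0≡1)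
≡0±-sum-unit {c = c} (inj₂ (inj₁ refl)) (inj₂ (inj₁ refl)) c+c≡1 =
  inj₂ (inj₂ (inj₁ (trans (x+x≡q⇒x≡½*q c 1ℚ c+c≡1) (*-identityʳ ½))))
≡0±-sum-unit {c = c} (inj₂ (inj₁ refl)) (inj₂ (inj₂ refl)) c-c≡1 =
  ⊥-elim (0≢1 (trans (sym (+-inverseʳ c)) c-c≡1))
≡0±-sum-unit {c = c} (inj₂ (inj₂ refl)) (inj₂ (inj₁ refl)) -c+c≡1 =
  ⊥-elim (0≢1 (trans (sym (+-inverseˡ c)) -c+c≡1))
≡0±-sum-unit {c = c} (inj₂ (inj₂ refl)) (inj₂ (inj₂ refl)) -c-c≡1 =
  inj₂ (inj₂ (inj₂ (x+x≡q⇒x≡½*q c (- 1ℚ) c+c≡-1)))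
  where
  c+c≡-1 : c + c ≡ - 1ℚ
  c+c≡-1 = begin
    c + c          ≡⟨ sym (⁻¹-involutive (c + c)) ⟩
    - - (c + c)    ≡⟨ cong -_ (neg-distrib-+ c c) ⟩
    - (- c + - c)  ≡⟨ cong -_ -c-c≡1 ⟩
    - 1ℚ           ∎

module Column {m} (A B : Matrix m)
  (binary : ∀ i j → A i j ≡ 0ℚ ⊎ A i j ≡ 1ℚ) (sparse : ∀ i → nnz (A i) ≤ 2)
  (AB≡I : ∀ i k → (A ⊗ B) i k ≡ I i k) (BA≡I : ∀ i k → (B ⊗ A) i k ≡ I i k)
  (j : Fin m) where

  x : Vector ℚ m
  x l = B l j

  Ax≡eⱼ : ∀ r → (A · x) r ≡ I r j
  Ax≡eⱼ r = trans (sym (Σ≡sum (λ k → A r k * x k))) (AB≡I r j)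

  column-values : ∀ i → x i ≢ 0ℚ → ∀ l → x l ≡0± x i
  column-values i xᵢ≢0 l = restrict±-fixed c (x l) (begin
    z l       ≡⟨ z≡μx l ⟩
    μ * x l   ≡⟨ cong (_* x l) μ≡1 ⟩
    1ℚ * x l  ≡⟨ *-identityˡ (x l) ⟩
    x l       ∎)
    where
    c = x i
    z : Vector ℚ m
    z = restrict± c ∘ x
    μ = (A · z) j

    Az≡μAx : ∀ r → (A · z) r ≡ (A · (λ k → μ * x k)) r
    Az≡μAx r with r Fin.≟ j
    ... | yes refl = sym (begin
      (A · (λ k → μ * x k)) j  ≡⟨ ·-scale A μ x j ⟩
      μ * (A · x) j            ≡⟨ cong (μ *_) (trans (Ax≡eⱼ j) (I-diag j)) ⟩
      μ * 1ℚ                   ≡⟨ *-identityʳ μ ⟩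
      μ                        ∎)
    ... | no r≢j = begin
      (A · z) r                ≡⟨ odd-preserves-kernel (restrict±-odd c) (A r) (binary r) (sparse r) x Axᵣ≡0 ⟩
      0ℚ                       ≡⟨ sym (*-zeroʳ μ) ⟩
      μ * 0ℚ                   ≡⟨ cong (μ *_) (sym Axᵣ≡0) ⟩
      μ * (A · x) r            ≡⟨ sym (·-scale A μ x r) ⟩
      (A · (λ k → μ * x k)) r  ∎
      where Axᵣ≡0 = trans (Ax≡eⱼ r) (I-off r≢j)

    z≡μx : ∀ l → z l ≡ μ * x l
    z≡μx = ·-injective A B BA≡I Az≡μAx

    μ≡1 : μ ≡ 1ℚ
    μ≡1 = *-identityˡ-unique μ c xᵢ≢0 (trans (sym (z≡μx i)) (restrict±-self c))

  Axⱼ≡1 : (A · x) j ≡ 1ℚ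
  Axⱼ≡1 = trans (Ax≡eⱼ j) (I-diag j)

  entry-value : ∀ i → x i ≢ 0ℚ → x i ≡ 1ℚ ⊎ x i ≡ - 1ℚ ⊎ x i ≡ ½ ⊎ x i ≡ -½
  entry-value i xᵢ≢0 with rowShape (A j) (binary j) (sparse j)
  ... | empty w∙≡    = ⊥-elim (0≢1 (trans (sym (w∙≡ x)) Axⱼ≡1))
  ... | single a w∙≡ = ≡0±-unit (column-values i xᵢ≢0 a) (trans (sym (w∙≡ x)) Axⱼ≡1)
  ... | pair a b w∙≡ =
    ≡0±-sum-unit (column-values i xᵢ≢0 a) (column-values i xᵢ≢0 b) (trans (sym (w∙≡ x)) Axⱼ≡1)

lemma1 : (m : ℕ) → m ≥ 1 → (A : Matrix m)
    → (∀ i j → A i j ≡ 0ℚ ⊎ A i j ≡ 1ℚ)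
    → (∀ i → nnz (A i) ≤ 2)
    → (B : Matrix m) → (∀ i k → (A ⊗ B) i k ≡ I i k) → (∀ i k → (B ⊗ A) i k ≡ I i k)
    → ∀ i j → B i j ≡ 0ℚ ⊎ B i j ≡ 1ℚ ⊎ B i j ≡ - 1ℚ ⊎ B i j ≡ ½ ⊎ B i j ≡ -½
lemma1 m _ A binary sparse B AB≡I BA≡I i j with B i j ≟ 0ℚ
... | yes Bᵢⱼ≡0 = inj₁ Bᵢⱼ≡0
... | no Bᵢⱼ≢0  = inj₂ (Column.entry-value A B binary sparse AB≡I BA≡I j i Bᵢⱼ≢0)
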